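{- Let $n \geq 2$ and let $G = \bigcup_{i=1}^{n} A_i$ be a graph which is the union of $n$ complete graphs $A_1, A_2, \dots, A_n$, each having exactly $n$ vertices, such that every pair of distinct complete graphs $A_i, A_j$ has at most one common vertex. Then for every integer $m \geq 2$, $G$ has at most $\binom{n}{2} \big/ \binom{m}{2}$ vertices of clique degree $m$.
   Context: For a vertex $v$ of $G$, the clique degree is $d^K(v) = |\{A_i : v \in V(A_i),\ 1 \leq i \leq n\}|$, the number of the complete graphs $A_i$ containing $v$. -}

module Defs where

open import Data.Nat using (ℕ; zero; suc; _+_; _≤_; s≤s; z≤n; NonZero)
open import Data.Nat.Combinatorics using (_C_; nC1≡n; nCk+nC[k+1]≡[n+1]C[k+1])
open import Data.Fin using (Fin)
open import Data.Fin.Subset using (Subset; _∈_; _∩_; ∣_∣)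
open import Data.Fin.Subset.Properties using (_∈?_)
open import Data.List using (List; length; filter)
open import Data.List using () renaming (allFin to allFinL)
open import Data.Nat.Properties using (_≟_)
open import Data.Product using (∃; Σ)
open import Relation.Binary.PropositionalEquality using (_≡_; subst; trans; cong; sym)

-- A union of cliques G = A₁ ∪ … ∪ Aₙ on the vertex set Fin N:
-- clique i has vertex set A i ⊆ Fin N.
-- Clique degree d^K(v) = |{ i : v ∈ V(A i) }|.
cliqueDegree : ∀ {N k} → (Fin k → Subset N) → Fin N → ℕ
cliqueDegree {N} {k} A v = length (filter (λ i → v ∈? A i) (allFinL k))

numVerticesOfDegree : ∀ {N k} → (Fin k → Subset N) → ℕ → ℕ
numVerticesOfDegree {N} A m = length (filter (λ v → cliqueDegree A v ≟ m) (allFinL N))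

CoversVertices : ∀ {N k} → (Fin k → Subset N) → Set
CoversVertices {N} A = ∀ (v : Fin N) → ∃ λ i → v ∈ A i

C2-nonZero : ∀ m → 2 ≤ m → NonZero (m C 2)
C2-nonZero (suc (suc k)) (s≤s (s≤s z≤n)) =
  subst NonZero (trans (cong (_+ (suc k C 2)) (sym (nC1≡n (suc k))))
                       (nCk+nC[k+1]≡[n+1]C[k+1] (suc k) 1)) _

-- Double counting: a vertex of clique degree d lies in d C 2 of the intersections
-- A i ∩ A j (i < j), so Σ_v d(v) C 2 = Σ_{i<j} ∣ A i ∩ A j ∣ ≤ n C 2, and each vertex
-- of degree m contributes m C 2 to the left-hand side.
module Submission where

open import Defs
open import Data.Bool using (Bool; true; false; _∧_)
open import Data.Fin using (Fin; zero; suc)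
open import Data.Fin.Subset using (Subset; _∩_; ∣_∣)
open import Data.Fin.Subset.Properties using (_∈?_)
open import Data.List using (List; []; _∷_; _++_; map; length; filter; tabulate; allFin)
open import Data.List.Properties using (length-tabulate)
open import Data.List.Relation.Unary.All using (All; []; _∷_)
open import Data.List.Relation.Unary.AllPairs as AllPairs using (AllPairs; []; _∷_)
open import Data.List.Relation.Unary.Unique.Propositional.Properties using (allFin⁺)
open import Data.Nat using (ℕ; zero; suc; _+_; _*_; _≤_; _/_; z≤n; NonZero)
open import Data.Nat.Combinatorics using (_C_; nC1≡n; nCk+nC[k+1]≡[n+1]C[k+1])
open import Data.Nat.DivMod using (m*n/n≡m; /-monoˡ-≤)
open import Data.Nat.Properties
open import Algebra.Properties.CommutativeSemigroup +-commutativeSemigroup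
  using () renaming (interchange to +-interchange)
import Data.Vec as Vec
open import Data.Product using (_×_; _,_; proj₁; proj₂)
open import Function using (_∘_)
open import Relation.Nullary using (Dec; yes; no; does)
open import Relation.Unary using (Decidable)
open import Relation.Binary.PropositionalEquality
  using (_≡_; _≢_; refl; sym; trans; cong; cong₂; subst; module ≡-Reasoning)

private
  variable
    X Y : Set

∑ : List X → (X → ℕ) → ℕ
∑ []       f = 0
∑ (x ∷ xs) f = f x + ∑ xs f

syntax ∑ xs (λ x → e) = ∑[ x ← xs ] e

𝟙 : Bool → ℕ
𝟙 true  = 1
𝟙 false = 0

∑-cong : (xs : List X) {f g : X → ℕ} → (∀ x → f x ≡ g x) → ∑ xs f ≡ ∑ xs g
∑-cong []       f≡g = refl
∑-cong (x ∷ xs) f≡g = cong₂ _+_ (f≡g x) (∑-cong xs f≡g)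

∑-mono-≤ : (xs : List X) {f g : X → ℕ} → (∀ x → f x ≤ g x) → ∑ xs f ≤ ∑ xs g
∑-mono-≤ []       f≤g = z≤n
∑-mono-≤ (x ∷ xs) f≤g = +-mono-≤ (f≤g x) (∑-mono-≤ xs f≤g)

∑-zero : (xs : List X) → ∑[ x ← xs ] 0 ≡ 0
∑-zero []       = refl
∑-zero (x ∷ xs) = ∑-zero xs

∑-+ : (xs : List X) (f g : X → ℕ) → ∑[ x ← xs ] (f x + g x) ≡ ∑ xs f + ∑ xs g
∑-+ []       f g = refl
∑-+ (x ∷ xs) f g = trans (cong (f x + g x +_) (∑-+ xs f g)) (+-interchange (f x) (g x) _ _)

∑-*ʳ : (xs : List X) (f : X → ℕ) (c : ℕ) → ∑ xs f * c ≡ ∑[ x ← xs ] (f x * c)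
∑-*ʳ []       f c = refl
∑-*ʳ (x ∷ xs) f c = trans (*-distribʳ-+ c (f x) (∑ xs f)) (cong (f x * c +_) (∑-*ʳ xs f c))

∑-++ : (xs ys : List X) (f : X → ℕ) → ∑ (xs ++ ys) f ≡ ∑ xs f + ∑ ys f
∑-++ []       ys f = refl
∑-++ (x ∷ xs) ys f = trans (cong (f x +_) (∑-++ xs ys f)) (sym (+-assoc (f x) (∑ xs f) (∑ ys f)))

∑-map : (g : X → Y) (xs : List X) (f : Y → ℕ) → ∑ (map g xs) f ≡ ∑ xs (f ∘ g)
∑-map g []       f = refl
∑-map g (x ∷ xs) f = cong (f (g x) +_) (∑-map g xs f)

∑-comm : (xs : List X) (ys : List Y) (f : X → Y → ℕ) →
         ∑[ x ← xs ] ∑[ y ← ys ] f x y ≡ ∑[ y ← ys ] ∑[ x ← xs ] f x y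
∑-comm []       ys f = sym (∑-zero ys)
∑-comm (x ∷ xs) ys f =
  trans (cong (∑ ys (f x) +_) (∑-comm xs ys f)) (sym (∑-+ ys (f x) (λ y → ∑[ x ← xs ] f x y)))

∑-tabulate : ∀ {n} (g : Fin n → X) (f : X → ℕ) → ∑ (tabulate g) f ≡ ∑ (allFin n) (f ∘ g)
∑-tabulate {n = zero}  g f = refl
∑-tabulate {n = suc n} g f = cong (f (g zero) +_)
  (trans (∑-tabulate (g ∘ suc) f) (sym (∑-tabulate suc (f ∘ g))))

length-filter≡∑𝟙 : {P : X → Set} (P? : Decidable P) (xs : List X) →
                   length (filter P? xs) ≡ ∑[ x ← xs ] 𝟙 (does (P? x))
length-filter≡∑𝟙 P? []       = refl
length-filter≡∑𝟙 P? (x ∷ xs) with does (P? x)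
... | true  = cong suc (length-filter≡∑𝟙 P? xs)
... | false = length-filter≡∑𝟙 P? xs

length-filter≟*≤∑ : (f : X → ℕ) (g : ℕ → ℕ) (m : ℕ) (xs : List X) →
                    length (filter (λ x → f x ≟ m) xs) * g m ≤ ∑[ x ← xs ] g (f x)
length-filter≟*≤∑ f g m xs = begin
  length (filter (λ x → f x ≟ m) xs) * g m  ≡⟨ cong (_* g m) (length-filter≡∑𝟙 (λ x → f x ≟ m) xs) ⟩
  ∑[ x ← xs ] 𝟙 (does (f x ≟ m)) * g m      ≡⟨ ∑-*ʳ xs _ (g m) ⟩
  ∑[ x ← xs ] (𝟙 (does (f x ≟ m)) * g m)    ≤⟨ ∑-mono-≤ xs (λ x → 𝟙*g≤ (f x) (f x ≟ m)) ⟩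
  ∑[ x ← xs ] g (f x)                        ∎
  where
  open ≤-Reasoning
  𝟙*g≤ : ∀ k → (k≟m : Dec (k ≡ m)) → 𝟙 (does k≟m) * g m ≤ g k
  𝟙*g≤ k (yes refl) = ≤-reflexive (+-identityʳ (g m))
  𝟙*g≤ k (no _)     = z≤n

pairs : List X → List (X × X)
pairs []       = []
pairs (x ∷ xs) = map (x ,_) xs ++ pairs xs

suc-C2 : ∀ c → c + c C 2 ≡ suc c C 2
suc-C2 c = trans (cong (_+ c C 2) (sym (nC1≡n c))) (nCk+nC[k+1]≡[n+1]C[k+1] c 1)

∑-pairs-𝟙∧≡C2 : {X : Set} (b : X → Bool) (xs : List X) →
                ∑[ p ← pairs xs ] 𝟙 (b (proj₁ p) ∧ b (proj₂ p)) ≡ (∑[ x ← xs ] 𝟙 (b x)) C 2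
∑-pairs-𝟙∧≡C2 b []       = refl
∑-pairs-𝟙∧≡C2 {X} b (x ∷ xs) = begin
  ∑ (map (x ,_) xs ++ pairs xs) both           ≡⟨ ∑-++ (map (x ,_) xs) (pairs xs) both ⟩
  ∑ (map (x ,_) xs) both + ∑ (pairs xs) both   ≡⟨ cong₂ _+_ (∑-map (x ,_) xs both) (∑-pairs-𝟙∧≡C2 b xs) ⟩
  ∑[ y ← xs ] 𝟙 (b x ∧ b y) + c C 2            ≡⟨ cong (_+ c C 2) (row (b x)) ⟩
  𝟙 (b x) * c + c C 2                          ≡⟨ add-𝟙 (b x) ⟩
  (𝟙 (b x) + c) C 2                            ∎
  where
  open ≡-Reasoning
  both : X × X → ℕ
  both p = 𝟙 (b (proj₁ p) ∧ b (proj₂ p))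
  c : ℕ
  c = ∑[ y ← xs ] 𝟙 (b y)
  row : ∀ bx → ∑[ y ← xs ] 𝟙 (bx ∧ b y) ≡ 𝟙 bx * c
  row true  = sym (+-identityʳ c)
  row false = ∑-zero xs
  add-𝟙 : ∀ bx → 𝟙 bx * c + c C 2 ≡ (𝟙 bx + c) C 2
  add-𝟙 true  = trans (cong (_+ c C 2) (+-identityʳ c)) (suc-C2 c)
  add-𝟙 false = refl

∑-pairs≤C2 : {X : Set} (h : X × X → ℕ) (xs : List X) →
             AllPairs (λ x y → h (x , y) ≤ 1) xs → ∑ (pairs xs) h ≤ length xs C 2
∑-pairs≤C2 h []       []                 = z≤n
∑-pairs≤C2 {X} h (x ∷ xs) (h[x,-]≤1 ∷ rest) = begin
  ∑ (map (x ,_) xs ++ pairs xs) h       ≡⟨ ∑-++ (map (x ,_) xs) (pairs xs) h ⟩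
  ∑ (map (x ,_) xs) h + ∑ (pairs xs) h  ≡⟨ cong (_+ ∑ (pairs xs) h) (∑-map (x ,_) xs h) ⟩
  ∑[ y ← xs ] h (x , y) + ∑ (pairs xs) h ≤⟨ +-mono-≤ (row xs h[x,-]≤1) (∑-pairs≤C2 h xs rest) ⟩
  length xs + length xs C 2             ≡⟨ suc-C2 (length xs) ⟩
  suc (length xs) C 2                   ∎
  where
  open ≤-Reasoning
  row : (ys : List X) → All (λ y → h (x , y) ≤ 1) ys → ∑[ y ← ys ] h (x , y) ≤ length ys
  row []       []         = z≤n
  row (y ∷ ys) (≤1 ∷ ≤1s) = +-mono-≤ ≤1 (row ys ≤1s)

∣∩∣≡∑𝟙 : ∀ {N} (S T : Subset N) →
         ∣ S ∩ T ∣ ≡ ∑[ v ← allFin N ] 𝟙 (does (v ∈? S) ∧ does (v ∈? T))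
∣∩∣≡∑𝟙 {zero}  Vec.[]      Vec.[]      = refl
∣∩∣≡∑𝟙 {suc N} (s Vec.∷ S) (t Vec.∷ T) = begin
  ∣ (s Vec.∷ S) ∩ (t Vec.∷ T) ∣                ≡⟨ head-𝟙 s t ⟩
  in-both zero + ∣ S ∩ T ∣                     ≡⟨ cong (in-both zero +_) (∣∩∣≡∑𝟙 S T) ⟩
  in-both zero + ∑ (allFin N) (in-both ∘ suc)  ≡⟨ cong (in-both zero +_) (∑-tabulate suc in-both) ⟨
  ∑ (allFin (suc N)) in-both                   ∎
  where
  open ≡-Reasoning
  in-both : Fin (suc N) → ℕ
  in-both v = 𝟙 (does (v ∈? (s Vec.∷ S)) ∧ does (v ∈? (t Vec.∷ T)))
  head-𝟙 : ∀ s t → ∣ (s Vec.∷ S) ∩ (t Vec.∷ T) ∣ ≡ 𝟙 (does (zero ∈? (s Vec.∷ S)) ∧ does (zero ∈? (t Vec.∷ T))) + ∣ S ∩ T ∣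
  head-𝟙 true  true  = refl
  head-𝟙 true  false = refl
  head-𝟙 false true  = refl
  head-𝟙 false false = refl

*≤⇒≤/ : ∀ a b c .{{_ : NonZero c}} → a * c ≤ b → a ≤ b / c
*≤⇒≤/ a b c a*c≤b = subst (_≤ b / c) (m*n/n≡m a c) (/-monoˡ-≤ c a*c≤b)

cliqueDegree-C2≡∑pairs : ∀ {N k} (A : Fin k → Subset N) (v : Fin N) →
  cliqueDegree A v C 2 ≡ ∑[ p ← pairs (allFin k) ] 𝟙 (does (v ∈? A (proj₁ p)) ∧ does (v ∈? A (proj₂ p)))
cliqueDegree-C2≡∑pairs {k = k} A v =
  trans (cong (_C 2) (length-filter≡∑𝟙 (λ i → v ∈? A i) (allFin k)))
        (sym (∑-pairs-𝟙∧≡C2 (λ i → does (v ∈? A i)) (allFin k)))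

corollary1 : (n : ℕ) → 2 ≤ n → (N : ℕ) → (A : Fin n → Subset N) →
    CoversVertices A →
    (∀ i → ∣ A i ∣ ≡ n) →
    (∀ i j → i ≢ j → ∣ A i ∩ A j ∣ ≤ 1) →
    (m : ℕ) → (2≤m : 2 ≤ m) →
    numVerticesOfDegree A m ≤ _/_ (n C 2) (m C 2) {{C2-nonZero m 2≤m}}
corollary1 n _ N A _ _ ∣A∩A∣≤1 m 2≤m = *≤⇒≤/ _ _ (m C 2) {{C2-nonZero m 2≤m}} (begin
  numVerticesOfDegree A m * (m C 2)               ≤⟨ length-filter≟*≤∑ (cliqueDegree A) (_C 2) m V ⟩
  ∑[ v ← V ] (cliqueDegree A v C 2)               ≡⟨ ∑-cong V (cliqueDegree-C2≡∑pairs A) ⟩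
  ∑[ v ← V ] ∑[ p ← pairs I ] in-both v p         ≡⟨ ∑-comm V (pairs I) in-both ⟩
  ∑[ p ← pairs I ] ∑[ v ← V ] in-both v p         ≡⟨ ∑-cong (pairs I) (λ (i , j) → ∣∩∣≡∑𝟙 (A i) (A j)) ⟨
  ∑[ p ← pairs I ] ∣ A (proj₁ p) ∩ A (proj₂ p) ∣  ≤⟨ ∑-pairs≤C2 _ I (AllPairs.map (∣A∩A∣≤1 _ _) (allFin⁺ n)) ⟩
  length I C 2                                    ≡⟨ cong (_C 2) (length-tabulate {n = n} (λ i → i)) ⟩
  n C 2                                           ∎)
  where
  open ≤-Reasoning
  I : List (Fin n)
  I = allFin n
  V : List (Fin N)
  V = allFin N
  in-both : Fin N → Fin n × Fin n → ℕ
  in-both v (i , j) = 𝟙 (does (v ∈? A i) ∧ does (v ∈? A j))
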